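{- Consider an instance of the Multiple Drone-Delivery Scheduling Problem (MDSP) with $m$ drones of battery capacity $B$ and $n$ jobs, and let $\Delta$ be the maximum, over all jobs $j$, of the number of other jobs whose intervals intersect $I_j$. Let $\mathcal{S}^* = \{S^*_1,\dots,S^*_{2m+\Delta}\}$ be the family of $2m+\Delta$ assignments held by the drones at the end of the correction phase (Step 3) of the Modified Greedy Algorithm described in the context. Then $$\mathcal{P}(\mathcal{S}^*) = \sum_{i=1}^{2m+\Delta}\mathcal{P}(S^*_i) \;\geq\; OPT,$$ where $OPT$ is the optimal value of the MDSP instance.
   Context: MDSP instance: there are $m$ identical drones, each with energy budget (battery) $B \ge 0$, and $n$ jobs (deliveries) $j=1,\dots,n$. Job $j$ has an open time interval $I_j=(t^L_j,t^R_j)$, an energy cost $c_j$ with $0\le c_j\le B$, and a reward $p_j\ge 0$. Two jobs $a,b$ conflict if $I_a\cap I_b\neq\varnothing$. An assignment is a set $S_i$ of jobs given to drone $i$; it is compatible if no two of its jobs conflict, and feasible if $\mathcal{W}(S_i)=\sum_{j\in S_i}c_j\le B$. Its reward is $\mathcal{P}(S_i)=\sum_{j\in S_i}p_j$, and the reward of a family of assignments is the sum of the rewards of its members. $OPT$ is the maximum of $\sum_{i=1}^m\mathcal{P}(S_i)$ over all families $(S_1,\dots,S_m)$ of pairwise disjoint, compatible, feasible assignments. The density of job $j$ is $d_j=p_j/c_j$ (taken as $+\infty$ if $c_j=0$). Modified Greedy Algorithm (uses $2m+\Delta$ drones, all initially with empty assignments): Step 1. Order the jobs so that $d_1\ge d_2\ge\dots\ge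 d_n$. Let $C=\varnothing$ be the set of critically-assigned drones. Step 2. For $j=1,\dots,n$: if $|C|\ge m$, stop this loop. Otherwise choose a drone $i\in\{1,\dots,m+\Delta\}\setminus C$ whose current assignment $S_i$ contains no job conflicting with $j$, and add $j$ to $S_i$; if now $\mathcal{W}(S_i)>B$, add $i$ to $C$ and set $L_i=j$. Step 3 (correction). Enumerate the critical drones as $i_1,\dots,i_{|C|}$. For the $k$-th critical drone $i=i_k$: if $\mathcal{P}(S_i\setminus\{L_i\})\ge p_{L_i}$, set $S_{m+\Delta+k}=\{L_i\}$ and $S_i=S_i\setminus\{L_i\}$; otherwise set $S_{m+\Delta+k}=S_i\setminus\{L_i\}$ and $S_i=\{L_i\}$. Step 4. Output the $m$ assignments of largest reward among the $2m+\Delta$ drones.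
   Formalization: The interval endpoints $t^L_j$ and $t^R_j$, the energy costs $c_j$, the rewards $p_j$ and the battery capacity $B$ are all rational numbers. -}

module Defs where

open import Data.Nat as ℕ using (ℕ; zero; suc)
open import Data.Fin as Fin using (Fin)
open import Data.Fin.Properties as FinP using ()
open import Data.Rational as ℚ using (ℚ; 0ℚ; _÷_)
open import Data.Rational.Properties as ℚP using ()
open import Data.List using (List; []; _∷_; _++_; [_]; length; map; filter; foldr; allFin)
open import Data.List.Membership.Propositional using (_∈_; _∉_)
open import Data.List.Relation.Unary.All using (All)
open import Data.List.Relation.Unary.Unique.Propositional using (Unique)
open import Data.List.Relation.Unary.AllPairs using (AllPairs)
open import Data.List.Relation.Binary.Permutation.Propositional using (_↭_)
open import Data.Maybe using (Maybe; just; nothing)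
open import Data.Product using (_×_; _,_; ∃; ∃-syntax; Σ-syntax)
open import Data.Sum using (_⊎_)
open import Data.Unit using (⊤)
open import Data.Empty using (⊥)
open import Relation.Nullary using (¬_; yes; no; ¬?)
open import Relation.Binary.PropositionalEquality using (_≡_; _≢_)

record Instance (n : ℕ) : Set where
  field
    B     : ℚ
    tL tR : Fin n → ℚ          -- I_j = (tL j , tR j), open interval
    c     : Fin n → ℚ
    p     : Fin n → ℚ
    B≥0   : 0ℚ ℚ.≤ B
    c≥0   : ∀ j → 0ℚ ℚ.≤ c j
    c≤B   : ∀ j → c j ℚ.≤ B
    p≥0   : ∀ j → 0ℚ ℚ.≤ p j

module _ {n : ℕ} (I : Instance n) where
  open Instance I

  Intersect : Fin n → Fin n → Set
  Intersect a b = ∃[ t ] ((tL a ℚ.< t × t ℚ.< tR a) × (tL b ℚ.< t × t ℚ.< tR b))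

  Conflict : Fin n → Fin n → Set
  Conflict a b = a ≢ b × Intersect a b

  -- W(S) and P(S); assignments are duplicate-free lists of jobs
  W : List (Fin n) → ℚ
  W S = foldr (λ j r → c j ℚ.+ r) 0ℚ S

  P : List (Fin n) → ℚ
  P S = foldr (λ j r → p j ℚ.+ r) 0ℚ S

  Pfam : List (List (Fin n)) → ℚ
  Pfam F = foldr (λ S r → P S ℚ.+ r) 0ℚ F

  Compatible : List (Fin n) → Set
  Compatible S = ∀ {a b} → a ∈ S → b ∈ S → ¬ Conflict a b

  Feasible : List (Fin n) → Set
  Feasible S = W S ℚ.≤ B

  ValidFamily : (m : ℕ) → (Fin m → List (Fin n)) → Set
  ValidFamily m S =
    (∀ i → Unique (S i) × Compatible (S i) × Feasible (S i)) ×
    (∀ i i' → i ≢ i' → ∀ {j} → j ∈ S i → j ∉ S i')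

  OPT≤ : (m : ℕ) → ℚ → Set
  OPT≤ m v = ∀ (S : Fin m → List (Fin n)) → ValidFamily m S →
             Pfam (map S (allFin m)) ℚ.≤ v

  ConflictSetOf : Fin n → List (Fin n) → Set
  ConflictSetOf j l = Unique l × All (λ k → k ≢ j × Intersect j k) l

  IsMaxDegree : ℕ → Set
  IsMaxDegree Δ =
    (∀ j l → ConflictSetOf j l → length l ℕ.≤ Δ) ×
    (Δ ≡ 0 ⊎ ∃[ j ] ∃[ l ] (ConflictSetOf j l × length l ≡ Δ))

  data ℚ∞ : Set where
    fin : ℚ → ℚ∞
    ∞   : ℚ∞

  data _≤∞_ : ℚ∞ → ℚ∞ → Set where
    fin≤fin : ∀ {x y} → x ℚ.≤ y → fin x ≤∞ fin y
    _≤∞∞    : ∀ x → x ≤∞ ∞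

  density : Fin n → ℚ∞
  density j with c j ℚP.≟ 0ℚ
  ... | yes _  = ∞
  ... | no c≢0 = fin ((p j ÷ c j) {{ℚ.≢-nonZero c≢0}})

  DensitySorted : List (Fin n) → Set
  DensitySorted = AllPairs (λ a b → density b ≤∞ density a)

  -- Modified Greedy Algorithm with m, Δ.  Drones 1..m+Δ are Fin (m + Δ);
  -- the extra drones m+Δ+1 .. 2m+Δ are indexed by k : Fin m.

  module Greedy (m Δ : ℕ) where

    D : ℕ
    D = m ℕ.+ Δ

    -- state: assignments of drones 1..m+Δ, and the list of critical
    -- drones in the order they became critical, each paired with L_i.
    record State : Set where
      constructor ⟨_,_⟩
      field
        S    : Fin D → List (Fin n)
        crit : List (Fin D × Fin n)
    open State public

    initial : State
    initial = ⟨ (λ _ → []) , [] ⟩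

    critDrones : State → List (Fin D)
    critDrones s = map Data.Product.proj₁ (crit s)

    addJob : State → Fin D → Fin n → State
    addJob s i j with B ℚP.<? W (j ∷ S s i)
    ... | yes _ = ⟨ S' , crit s ++ [ (i , j) ] ⟩
      where S' : Fin D → List (Fin n)
            S' k with k FinP.≟ i
            ... | yes _ = j ∷ S s i
            ... | no  _ = S s k
    ... | no  _ = ⟨ S' , crit s ⟩
      where S' : Fin D → List (Fin n)
            S' k with k FinP.≟ i
            ... | yes _ = j ∷ S s i
            ... | no  _ = S s k

    -- Step 2 as a relation: GreedyRun s js s' means that processing the
    -- remaining jobs js from state s can end in state s' (for some choice
    -- of drones).
    data GreedyRun : State → List (Fin n) → State → Set where
      done : ∀ {s} → GreedyRun s [] s
      stop : ∀ {s j js} → m ℕ.≤ length (crit s) → GreedyRun s (j ∷ js) s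
      step : ∀ {s j js s'} → length (crit s) ℕ.< m →
             (i : Fin D) → i ∉ critDrones s →
             All (λ k → ¬ Conflict k j) (S s i) →
             GreedyRun (addJob s i j) js s' →
             GreedyRun s (j ∷ js) s'

    remove : Fin n → List (Fin n) → List (Fin n)
    remove L = filter (λ k → ¬? (k FinP.≟ L))

    findCrit : Fin D → List (Fin D × Fin n) → Maybe (Fin n)
    findCrit i [] = nothing
    findCrit i ((i' , L) ∷ cs) with i FinP.≟ i'
    ... | yes _ = just L
    ... | no  _ = findCrit i cs

    nth : {A : Set} → List A → ℕ → Maybe A
    nth []       _       = nothing
    nth (x ∷ xs) zero    = just x
    nth (x ∷ xs) (suc k) = nth xs k

    correctedMain : State → Fin D → List (Fin n)
    correctedMain s i with findCrit i (crit s)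
    ... | nothing = S s i
    ... | just L with p L ℚP.≤? P (remove L (S s i))
    ...   | yes _ = remove L (S s i)
    ...   | no  _ = [ L ]

    correctedExtra : State → Fin m → List (Fin n)
    correctedExtra s k with nth (crit s) (Fin.toℕ k)
    ... | nothing = []
    ... | just (i , L) with p L ℚP.≤? P (remove L (S s i))
    ...   | yes _ = [ L ]
    ...   | no  _ = remove L (S s i)

    corrected : State → List (List (Fin n))
    corrected s = map (correctedMain s) (allFin D) ++ map (correctedExtra s) (allFin m)

-- The greedy phase processes a prefix A of the density order, and its drones partition A.
-- If it ran out of jobs, every valid family U satisfies U ⊆ A.  Otherwise m drones are
-- overloaded, so W(A) ≥ m·B ≥ W(U).  With t the density of the first unprocessed job,
-- jobs outside A have p ≤ t·c and jobs in A have p ≥ t·c; splitting p = (p − t·c) + t·c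
-- gives P(U) ≤ P(A), as in weak duality for the fractional knapsack.  (If that job costs
-- nothing, neither does any job of A, and no drone could be overloaded.)  The correction
-- step splits each overloaded S_i into S_i ∖ {L_i} and {L_i}, so it keeps the reward P(A).
module Submission where

open import Defs
open import Data.Nat using (ℕ)
import Data.Nat as ℕ
import Data.Nat.Properties as ℕ
open import Data.Fin using (Fin; zero; suc; toℕ)
import Data.Fin.Properties as Fin
open import Data.Maybe using (Maybe; just; nothing; maybe)
open import Data.Product using (∃; ∃₂; _×_; _,_; proj₁; proj₂)
open import Data.Sum using (_⊎_; inj₁; inj₂; map₂)
open import Data.Rational
  using (ℚ; 0ℚ; _+_; _*_; _-_; -_; _÷_; 1/_; _≤_; _<_;
         NonZero; NonNegative; Positive; ≢-nonZero; positive; nonNegative)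
open import Data.Rational.Properties
open import Data.Rational.Solver using (module +-*-Solver)
open import Data.List using (List; []; _∷_; _++_; [_]; map; concat; foldr; length; allFin)
open import Data.List.Properties
  using (foldr-map; map-tabulate; map-cong-local; map-++; length-++; length-tabulate; ++-assoc; ++-identityʳ)
open import Data.List.Relation.Unary.All as All using (All; []; _∷_)
import Data.List.Relation.Unary.All.Properties as Allₚ
open import Data.List.Relation.Unary.Any using (here; there)
open import Data.List.Relation.Unary.AllPairs using (AllPairs; []; _∷_)
import Data.List.Relation.Unary.AllPairs.Properties as AllPairsₚ
open import Data.List.Relation.Unary.Unique.Propositional using (Unique)
import Data.List.Relation.Unary.Unique.Propositional.Properties as Uniqueₚ
open import Data.List.Relation.Binary.Subset.Propositional using (_⊆_)
open import Data.List.Membership.Propositional using (_∈_; _∉_)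
open import Data.List.Membership.Propositional.Properties
  using (∈-∃++; ∈-map⁺; ∈-concat⁺′; ∈-allFin; ∈-filter⁺; ∈-++⁻)
open import Data.List.Relation.Binary.Permutation.Propositional
  using (_↭_; ↭-reflexive; ↭-prep; ↭-sym; ↭⇒↭ₛ; module PermutationReasoning)
open import Data.List.Relation.Binary.Permutation.Propositional.Properties
  using (map⁺; shift; ++⁺ˡ; ∷↭∷ʳ; ∈-resp-↭; All-resp-↭)
import Data.List.Relation.Binary.Permutation.Setoid.Properties as Setoid↭
open import Function using (id; _∘_)
open import Relation.Nullary using (yes; no; ¬?; contradiction)
open import Relation.Binary.PropositionalEquality
  using (_≡_; _≢_; refl; sym; trans; cong; cong₂; subst; setoid; module ≡-Reasoning)

p≤q⇒p-q≤0 : ∀ {p q} → p ≤ q → p - q ≤ 0ℚ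
p≤q⇒p-q≤0 {p} {q} p≤q = ≤-trans (+-monoˡ-≤ (- q) p≤q) (≤-reflexive (+-inverseʳ q))

p≤q⇒0≤q-p : ∀ {p q} → p ≤ q → 0ℚ ≤ q - p
p≤q⇒0≤q-p {p} {q} p≤q = ≤-trans (≤-reflexive (sym (+-inverseʳ p))) (+-monoˡ-≤ (- p) p≤q)

-- P I, W I and Pfam I are definitionally sumBy p, sumBy c and sumBy (P I).
sumBy : {A : Set} → (A → ℚ) → List A → ℚ
sumBy f = foldr (λ x r → f x + r) 0ℚ

module _ {A : Set} where

  sumBy-++ : ∀ (f : A → ℚ) xs ys → sumBy f (xs ++ ys) ≡ sumBy f xs + sumBy f ys
  sumBy-++ f []       ys = sym (+-identityˡ _)
  sumBy-++ f (x ∷ xs) ys = trans (cong (f x +_) (sumBy-++ f xs ys)) (sym (+-assoc (f x) _ _))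

  sumBy-concat : ∀ (f : A → ℚ) xss → sumBy f (concat xss) ≡ sumBy (sumBy f) xss
  sumBy-concat f []         = refl
  sumBy-concat f (xs ∷ xss) = trans (sumBy-++ f xs (concat xss)) (cong (sumBy f xs +_) (sumBy-concat f xss))

  sumBy-map : ∀ {B : Set} (f : B → ℚ) (g : A → B) xs → sumBy f (map g xs) ≡ sumBy (f ∘ g) xs
  sumBy-map f g []       = refl
  sumBy-map f g (x ∷ xs) = cong (f (g x) +_) (sumBy-map f g xs)

  sumBy-cong : ∀ {f g : A → ℚ} {xs} → All (λ x → f x ≡ g x) xs → sumBy f xs ≡ sumBy g xs
  sumBy-cong []           = refl
  sumBy-cong (fx≡gx ∷ eq) = cong₂ _+_ fx≡gx (sumBy-cong eq)

  sumBy-mono : ∀ {f g : A → ℚ} {xs} → All (λ x → f x ≤ g x) xs → sumBy f xs ≤ sumBy g xs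
  sumBy-mono []           = ≤-refl
  sumBy-mono (fx≤gx ∷ le) = +-mono-≤ fx≤gx (sumBy-mono le)

  sumBy-nonNeg : ∀ {f : A → ℚ} {xs} → All (λ x → 0ℚ ≤ f x) xs → 0ℚ ≤ sumBy f xs
  sumBy-nonNeg []          = ≤-refl
  sumBy-nonNeg (0≤fx ∷ nn) = +-mono-≤ 0≤fx (sumBy-nonNeg nn)

  sumBy-nonPos : ∀ {f : A → ℚ} {xs} → All (λ x → f x ≤ 0ℚ) xs → sumBy f xs ≤ 0ℚ
  sumBy-nonPos []          = ≤-refl
  sumBy-nonPos (fx≤0 ∷ np) = +-mono-≤ fx≤0 (sumBy-nonPos np)

  sumBy-+ : ∀ (f g : A → ℚ) xs → sumBy (λ x → f x + g x) xs ≡ sumBy f xs + sumBy g xs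
  sumBy-+ f g []       = sym (+-identityˡ 0ℚ)
  sumBy-+ f g (x ∷ xs) = trans (cong (f x + g x +_) (sumBy-+ f g xs))
    (solve 4 (λ a b c d → (a :+ b) :+ (c :+ d) := (a :+ c) :+ (b :+ d)) refl (f x) (g x) (sumBy f xs) (sumBy g xs))
    where open +-*-Solver

  sumBy-↭ : ∀ (f : A → ℚ) {xs ys} → xs ↭ ys → sumBy f xs ≡ sumBy f ys
  sumBy-↭ f {xs} {ys} xs↭ys = begin
    sumBy f xs                ≡⟨ foldr-map _+_ f 0ℚ xs ⟨
    foldr _+_ 0ℚ (map f xs)   ≡⟨ Setoid↭.foldr-commMonoid (setoid ℚ) +-0-isCommutativeMonoid
                                    (↭⇒↭ₛ (map⁺ f xs↭ys)) ⟩
    foldr _+_ 0ℚ (map f ys)   ≡⟨ foldr-map _+_ f 0ℚ ys ⟩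
    sumBy f ys                ∎
    where open ≡-Reasoning

  sumBy-split : ∀ (f g : A → ℚ) t xs → sumBy f xs ≡ sumBy (λ x → f x - t * g x) xs + t * sumBy g xs
  sumBy-split f g t []       = sym (trans (+-identityˡ _) (*-zeroʳ t))
  sumBy-split f g t (x ∷ xs) = trans (cong (f x +_) (sumBy-split f g t xs))
    (solve 5 (λ fx gx t e s → fx :+ (e :+ t :* s) := (fx :- t :* gx :+ e) :+ t :* (gx :+ s))
           refl (f x) (g x) t (sumBy (λ x → f x - t * g x) xs) (sumBy g xs))
    where open +-*-Solver

  ∈⇒↭∷ : ∀ {x : A} {ys} → x ∈ ys → ∃ λ zs → ys ↭ x ∷ zs
  ∈⇒↭∷ x∈ys with ys₁ , ys₂ , refl ← ∈-∃++ x∈ys = ys₁ ++ ys₂ , shift _ ys₁ ys₂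

  sumBy-≤-support : ∀ {f : A → ℚ} {xs ys} → Unique xs →
    All (λ x → x ∈ ys ⊎ f x ≤ 0ℚ) xs → All (λ y → 0ℚ ≤ f y) ys → sumBy f xs ≤ sumBy f ys
  sumBy-≤-support [] [] nonNeg = sumBy-nonNeg nonNeg
  sumBy-≤-support {f} {x ∷ xs} {ys} (_ ∷ u) (inj₂ fx≤0 ∷ inSupport) nonNeg = begin
    f x + sumBy f xs  ≤⟨ +-mono-≤ fx≤0 (sumBy-≤-support u inSupport nonNeg) ⟩
    0ℚ + sumBy f ys   ≡⟨ +-identityˡ _ ⟩
    sumBy f ys        ∎
    where open ≤-Reasoning
  sumBy-≤-support {f} {x ∷ xs} {ys} (x∉xs ∷ u) (inj₁ x∈ys ∷ inSupport) nonNeg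
    with zs , ys↭x∷zs ← ∈⇒↭∷ x∈ys = begin
    f x + sumBy f xs  ≤⟨ +-monoʳ-≤ (f x) (sumBy-≤-support u (All.zipWith shrink (x∉xs , inSupport))
                                            (All.tail (All-resp-↭ ys↭x∷zs nonNeg))) ⟩
    f x + sumBy f zs  ≡⟨ sumBy-↭ f ys↭x∷zs ⟨
    sumBy f ys        ∎
    where
    open ≤-Reasoning
    shrink : ∀ {z} → x ≢ z × (z ∈ ys ⊎ f z ≤ 0ℚ) → z ∈ zs ⊎ f z ≤ 0ℚ
    shrink (_   , inj₂ fz≤0) = inj₂ fz≤0
    shrink (x≢z , inj₁ z∈ys) with ∈-resp-↭ ys↭x∷zs z∈ys
    ... | here z≡x   = contradiction (sym z≡x) x≢z
    ... | there z∈zs = inj₁ z∈zs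

  sumBy-mono-⊆ : ∀ {f : A → ℚ} {xs ys} → Unique xs → xs ⊆ ys → All (λ y → 0ℚ ≤ f y) ys →
                 sumBy f xs ≤ sumBy f ys
  sumBy-mono-⊆ u xs⊆ys = sumBy-≤-support u (All.tabulate (inj₁ ∘ xs⊆ys))

  sumBy-≤-threshold : ∀ (f g : A → ℚ) t {xs ys} → Unique xs →
    All (λ x → x ∈ ys ⊎ f x ≤ t * g x) xs → All (λ y → t * g y ≤ f y) ys →
    t * sumBy g xs ≤ t * sumBy g ys → sumBy f xs ≤ sumBy f ys
  sumBy-≤-threshold f g t {xs} {ys} u below above budget = begin
    sumBy f xs                   ≡⟨ sumBy-split f g t xs ⟩
    sumBy e xs + t * sumBy g xs  ≤⟨ +-mono-≤ (sumBy-≤-support u (All.map (map₂ p≤q⇒p-q≤0) below)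
                                                                 (All.map p≤q⇒0≤q-p above)) budget ⟩
    sumBy e ys + t * sumBy g ys  ≡⟨ sumBy-split f g t ys ⟨
    sumBy f ys                   ∎
    where
    open ≤-Reasoning
    e : A → ℚ
    e x = f x - t * g x

  sumBy-update : ∀ {f g : A → ℚ} {i xs} → Unique xs → i ∈ xs → (∀ {x} → x ≢ i → f x ≡ g x) →
                 sumBy f xs ≡ sumBy g xs + (f i - g i)
  sumBy-update {f} {g} {i} {i ∷ xs} (i∉xs ∷ _) (here refl) agree = begin
    f i + sumBy f xs                   ≡⟨ cong (f i +_) (sumBy-cong (All.map (λ i≢x → agree (i≢x ∘ sym)) i∉xs)) ⟩
    f i + sumBy g xs                   ≡⟨ solve 3 (λ fi gi s → fi :+ s := (gi :+ s) :+ (fi :- gi)) refl (f i) (g i) _ ⟩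
    (g i + sumBy g xs) + (f i - g i)   ∎
    where open ≡-Reasoning
          open +-*-Solver
  sumBy-update {f} {g} {i} {x ∷ xs} (x∉xs ∷ u) (there i∈xs) agree = begin
    f x + sumBy f xs                   ≡⟨ cong₂ _+_ (agree (All.lookup x∉xs i∈xs)) (sumBy-update u i∈xs agree) ⟩
    g x + (sumBy g xs + (f i - g i))   ≡⟨ +-assoc (g x) _ _ ⟨
    (g x + sumBy g xs) + (f i - g i)   ∎
    where open ≡-Reasoning

sumBy-const-mono : ∀ {A B : Set} (b : ℚ) → 0ℚ ≤ b → (xs : List A) (ys : List B) →
                   length xs ℕ.≤ length ys → sumBy (λ _ → b) xs ≤ sumBy (λ _ → b) ys
sumBy-const-mono b 0≤b []       ys       _            = sumBy-nonNeg (All.universal (λ _ → 0≤b) ys)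
sumBy-const-mono b 0≤b (x ∷ xs) (y ∷ ys) (ℕ.s≤s len≤) = +-monoʳ-≤ b (sumBy-const-mono b 0≤b xs ys len≤)

sumBy-allFin-suc : ∀ {k} (f : Fin (ℕ.suc k) → ℚ) →
                   sumBy f (allFin (ℕ.suc k)) ≡ f zero + sumBy (f ∘ suc) (allFin k)
sumBy-allFin-suc {k} f = cong (f zero +_) (trans (cong (sumBy f) (sym (map-tabulate id suc)))
                                                (sumBy-map f suc (allFin k)))

module _ {K A : Set} where

  concat-map-update : ∀ {F G : K → List A} {i y xs} → Unique xs → i ∈ xs →
    G i ≡ y ∷ F i → (∀ {k} → k ≢ i → G k ≡ F k) → concat (map G xs) ↭ y ∷ concat (map F xs)
  concat-map-update {F} {G} {i} {y} {i ∷ xs} (i∉xs ∷ _) (here refl) Gi≡y∷Fi agree =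
    ↭-reflexive (cong₂ _++_ Gi≡y∷Fi
      (cong concat (map-cong-local (All.map (λ i≢k → agree (i≢k ∘ sym)) i∉xs))))
  concat-map-update {F} {G} {i} {y} {x ∷ xs} (x∉xs ∷ u) (there i∈xs) Gi≡y∷Fi agree = begin
    G x ++ concat (map G xs)      ≡⟨ cong (_++ concat (map G xs)) (agree (All.lookup x∉xs i∈xs)) ⟩
    F x ++ concat (map G xs)      ↭⟨ ++⁺ˡ (F x) (concat-map-update u i∈xs Gi≡y∷Fi agree) ⟩
    F x ++ y ∷ concat (map F xs)  ↭⟨ shift y (F x) _ ⟩
    y ∷ F x ++ concat (map F xs)  ∎
    where open PermutationReasoning

AllPairs-++⁻ : ∀ {A : Set} {R : A → A → Set} xs {ys} → AllPairs R (xs ++ ys) →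
               All (λ x → All (R x) ys) xs × AllPairs R ys
AllPairs-++⁻ []       pairs               = [] , pairs
AllPairs-++⁻ (x ∷ xs) (x-xs++ys ∷ pairs) with across , pairs′ ← AllPairs-++⁻ xs pairs =
  Allₚ.++⁻ʳ xs x-xs++ys ∷ across , pairs′

module _ {n : ℕ} (I : Instance n) where
  open Instance I

  data DensityView (j : Fin n) : ℚ∞ I → Set where
    free   : c j ≡ 0ℚ → DensityView j ∞
    priced : ∀ d → 0ℚ ≤ d → d * c j ≡ p j → DensityView j (fin d)

  densityView : ∀ j → DensityView j (density I j)
  densityView j with c j ≟ 0ℚ
  ... | yes c≡0 = free c≡0
  ... | no  c≢0 = priced d 0≤d d*c≡p
    where
    0<c : 0ℚ < c j
    0<c with 0ℚ <? c j
    ... | yes 0<c = 0<c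
    ... | no  0≮c = contradiction (≤-antisym (≮⇒≥ 0≮c) (c≥0 j)) c≢0
    instance
      _ : NonZero (c j)
      _ = ≢-nonZero c≢0
      _ : Positive (c j)
      _ = positive 0<c
    d : ℚ
    d = p j ÷ c j
    d*c≡p : d * c j ≡ p j
    d*c≡p = trans (*-assoc (p j) (1/ c j) (c j)) (trans (cong (p j *_) (*-inverseˡ (c j))) (*-identityʳ (p j)))
    0≤d : 0ℚ ≤ d
    0≤d = *-cancelʳ-≤-pos (c j)
            (≤-trans (≤-reflexive (*-zeroˡ (c j))) (≤-trans (p≥0 j) (≤-reflexive (sym d*c≡p))))

  instance
    c-nonNeg : ∀ {j} → NonNegative (c j)
    c-nonNeg {j} = nonNegative (c≥0 j)

  density≤fin⇒p≤*c : ∀ {j t} → _≤∞_ I (density I j) (fin t) → p j ≤ t * c j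
  density≤fin⇒p≤*c {j} {t} le with density I j | densityView j
  density≤fin⇒p≤*c {j} {t} (fin≤fin d≤t) | fin d | priced .d _ d*c≡p =
    ≤-trans (≤-reflexive (sym d*c≡p)) (*-monoʳ-≤-nonNeg (c j) d≤t)

  fin≤density⇒*c≤p : ∀ {j t} → _≤∞_ I (fin t) (density I j) → t * c j ≤ p j
  fin≤density⇒*c≤p {j} {t} le with density I j | densityView j
  ... | ∞ | free c≡0 = ≤-trans (≤-reflexive (trans (cong (t *_) c≡0) (*-zeroʳ t))) (p≥0 j)
  fin≤density⇒*c≤p {j} {t} (fin≤fin t≤d) | fin d | priced .d _ d*c≡p =
    ≤-trans (*-monoʳ-≤-nonNeg (c j) t≤d) (≤-reflexive d*c≡p)

  ∞≤density⇒c≡0 : ∀ {j} → _≤∞_ I ∞ (density I j) → c j ≡ 0ℚ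
  ∞≤density⇒c≡0 {j} le with density I j | densityView j
  ... | ∞ | free c≡0 = c≡0

  DensitySorted-split : ∀ A {r rs} → DensitySorted I (A ++ r ∷ rs) →
    All (λ a → _≤∞_ I (density I r) (density I a)) A × All (λ j → _≤∞_ I (density I j) (density I r)) rs
  DensitySorted-split A sorted with above , r-rs ∷ _ ← AllPairs-++⁻ A sorted = All.map All.head above , r-rs

  module _ (m Δ : ℕ) where
    open Greedy I m Δ

    addJob-self : ∀ s i j → S (addJob s i j) i ≡ j ∷ S s i
    addJob-self s i j with B <? W I (j ∷ S s i)
    ... | yes _ with i Fin.≟ i
    ...   | yes _   = refl
    ...   | no  i≢i = contradiction refl i≢i
    addJob-self s i j | no _ with i Fin.≟ i
    ...   | yes _   = refl
    ...   | no  i≢i = contradiction refl i≢i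

    addJob-other : ∀ s i j {k} → k ≢ i → S (addJob s i j) k ≡ S s k
    addJob-other s i j {k} k≢i with B <? W I (j ∷ S s i)
    ... | yes _ with k Fin.≟ i
    ...   | yes k≡i = contradiction k≡i k≢i
    ...   | no  _   = refl
    addJob-other s i j {k} k≢i | no _ with k Fin.≟ i
    ...   | yes k≡i = contradiction k≡i k≢i
    ...   | no  _   = refl

    addJob-crit : ∀ s i j (Q : List (Fin D × Fin n) → Set) →
                  (B < W I (j ∷ S s i) → Q (crit s ++ [ (i , j) ])) → Q (crit s) → Q (crit (addJob s i j))
    addJob-crit s i j Q overloaded fits with B <? W I (j ∷ S s i)
    ... | yes B<W = overloaded B<W
    ... | no  _   = fits

    Overloaded : State → Fin D → Set
    Overloaded s i = B < W I (S s i)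

    record Invariant (s : State) (A : List (Fin n)) : Set where
      field
        partition  : concat (map (S s) (allFin D)) ↭ A
        unique     : ∀ i → Unique (S s i)
        critUnique : Unique (critDrones s)
        overloaded : All (Overloaded s ∘ proj₁) (crit s)
        critBound  : length (crit s) ℕ.≤ m

    open Invariant

    assigned⊆ : ∀ {s A} → Invariant s A → ∀ i → S s i ⊆ A
    assigned⊆ {s} inv i x∈Si = ∈-resp-↭ (partition inv) (∈-concat⁺′ x∈Si (∈-map⁺ (S s) (∈-allFin i)))

    sumBy-assigned : ∀ {s A} → Invariant s A → ∀ f → sumBy (sumBy f ∘ S s) (allFin D) ≡ sumBy f A
    sumBy-assigned {s} {A} inv f = begin
      sumBy (sumBy f ∘ S s) (allFin D)         ≡⟨ sumBy-map (sumBy f) (S s) (allFin D) ⟨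
      sumBy (sumBy f) (map (S s) (allFin D))   ≡⟨ sumBy-concat f (map (S s) (allFin D)) ⟨
      sumBy f (concat (map (S s) (allFin D)))  ≡⟨ sumBy-↭ f (partition inv) ⟩
      sumBy f A                                ∎
      where open ≡-Reasoning

    initial-invariant : Invariant initial []
    initial-invariant = record
      { partition  = ↭-reflexive (nothingAssigned (allFin D))
      ; unique     = λ _ → []
      ; critUnique = []
      ; overloaded = []
      ; critBound  = ℕ.z≤n
      }
      where
      nothingAssigned : ∀ is → concat (map (S initial) is) ≡ []
      nothingAssigned []       = refl
      nothingAssigned (_ ∷ is) = nothingAssigned is

    addJob-invariant : ∀ {s A i j} → Invariant s A → length (crit s) ℕ.< m → i ∉ critDrones s → j ∉ A →
                       Invariant (addJob s i j) (A ++ [ j ])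
    addJob-invariant {s} {A} {i} {j} inv room i∉C j∉A = record
      { partition  = partition′
      ; unique     = unique′
      ; critUnique = addJob-crit s i j (Unique ∘ map proj₁)
                       (λ _ → subst Unique (sym (map-++ proj₁ (crit s) _))
                                (Uniqueₚ.++⁺ (critUnique inv) ([] ∷ []) λ { (i∈C , here refl) → i∉C i∈C }))
                       (critUnique inv)
      ; overloaded = addJob-crit s i j (All (Overloaded s′ ∘ proj₁))
                       (λ B<W → Allₚ.∷ʳ⁺ stillOverloaded (subst (λ xs → B < W I xs) (sym (addJob-self s i j)) B<W))
                       stillOverloaded
      ; critBound  = addJob-crit s i j (λ cs → length cs ℕ.≤ m)
                       (λ _ → subst (ℕ._≤ m) (sym (trans (length-++ (crit s)) (ℕ.+-comm _ 1))) room)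
                       (critBound inv)
      }
      where
      s′ : State
      s′ = addJob s i j

      partition′ : concat (map (S s′) (allFin D)) ↭ A ++ [ j ]
      partition′ = begin
        concat (map (S s′) (allFin D))     ↭⟨ concat-map-update (Uniqueₚ.allFin⁺ D) (∈-allFin i)
                                                (addJob-self s i j) (addJob-other s i j) ⟩
        j ∷ concat (map (S s) (allFin D))  ↭⟨ ↭-prep j (partition inv) ⟩
        j ∷ A                              ↭⟨ ∷↭∷ʳ j A ⟩
        A ++ [ j ]                         ∎
        where open PermutationReasoning

      unique′ : ∀ k → Unique (S s′ k)
      unique′ k with k Fin.≟ i
      ... | yes refl = subst Unique (sym (addJob-self s i j))
                         (All.tabulate (λ x∈Si j≡x → j∉A (subst (_∈ A) (sym j≡x) (assigned⊆ inv i x∈Si)))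
                          ∷ unique inv i)
      ... | no  k≢i  = subst Unique (sym (addJob-other s i j k≢i)) (unique inv k)

      stillOverloaded : All (Overloaded s′ ∘ proj₁) (crit s)
      stillOverloaded = All.tabulate λ {(k , _)} kL∈crit →
        subst (λ xs → B < W I xs) (sym (addJob-other s i j λ { refl → i∉C (∈-map⁺ proj₁ kL∈crit) }))
              (All.lookup (overloaded inv) kL∈crit)

    data Halted (s : State) : List (Fin n) → Set where
      exhausted : Halted s []
      saturated : ∀ {r rs} → m ℕ.≤ length (crit s) → Halted s (r ∷ rs)

    greedyRun-invariant : ∀ {s R s′} A → Invariant s A → Unique (A ++ R) → GreedyRun s R s′ →
      ∃₂ λ A′ R′ → A ++ R ≡ A′ ++ R′ × Invariant s′ A′ × Halted s′ R′
    greedyRun-invariant A inv _ done        = A , [] , refl , inv , exhausted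
    greedyRun-invariant A inv _ (stop full) = A , _ , refl , inv , saturated full
    greedyRun-invariant {R = j ∷ R} A inv u (step room i i∉C _ run) =
      let A′ , R′ , eq , inv′ , halted = greedyRun-invariant (A ++ [ j ]) (addJob-invariant inv room i∉C j∉A)
                                           (subst Unique (sym (++-assoc A [ j ] R)) u) run
      in A′ , R′ , trans (sym (++-assoc A [ j ] R)) eq , inv′ , halted
      where
      j∉A : j ∉ A
      j∉A j∈A = All.head (All.lookup (proj₁ (AllPairs-++⁻ A u)) j∈A) refl

    mainPart : State → Fin D → Fin n → List (Fin n)
    mainPart s i L with p L ≤? P I (remove L (S s i))
    ... | yes _ = remove L (S s i)
    ... | no  _ = [ L ]

    extraPart : State → Fin D × Fin n → List (Fin n)
    extraPart s (i , L) with p L ≤? P I (remove L (S s i))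
    ... | yes _ = [ L ]
    ... | no  _ = remove L (S s i)

    correctedMain-findCrit : ∀ s i → correctedMain s i ≡ maybe (mainPart s i) (S s i) (findCrit i (crit s))
    correctedMain-findCrit s i with findCrit i (crit s)
    ... | nothing = refl
    ... | just L with p L ≤? P I (remove L (S s i))
    ...   | yes _ = refl
    ...   | no  _ = refl

    correctedExtra-nth : ∀ s k → correctedExtra s k ≡ maybe (extraPart s) [] (nth (crit s) (toℕ k))
    correctedExtra-nth s k with nth (crit s) (toℕ k)
    ... | nothing = refl
    ... | just (i , L) with p L ≤? P I (remove L (S s i))
    ...   | yes _ = refl
    ...   | no  _ = refl

    P-remove : ∀ L {xs} → Unique xs → P I xs ≤ p L + P I (remove L xs)
    P-remove L {xs} u = sumBy-mono-⊆ u xs⊆L∷rest (All.universal p≥0 _)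
      where
      xs⊆L∷rest : xs ⊆ L ∷ remove L xs
      xs⊆L∷rest {x} x∈xs with x Fin.≟ L
      ... | yes refl = here refl
      ... | no  x≢L  = there (∈-filter⁺ (λ k → ¬? (k Fin.≟ L)) x∈xs x≢L)

    P-split : ∀ s i L → Unique (S s i) → P I (S s i) ≤ P I (mainPart s i L) + P I (extraPart s (i , L))
    P-split s i L u with p L ≤? P I (remove L (S s i))
    ... | yes _ = ≤-trans (P-remove L u)
                    (≤-reflexive (trans (+-comm (p L) _) (cong (P I (remove L (S s i)) +_) (sym (+-identityʳ (p L))))))
    ... | no  _ = ≤-trans (P-remove L u) (≤-reflexive (cong (_+ P I (remove L (S s i))) (sym (+-identityʳ (p L)))))

    findCrit-∉ : ∀ {i} cs → i ∉ map proj₁ cs → findCrit i cs ≡ nothing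
    findCrit-∉ []              _   = refl
    findCrit-∉ {i} ((k , L) ∷ cs) i∉ with i Fin.≟ k
    ... | yes i≡k = contradiction (here i≡k) i∉
    ... | no  _   = findCrit-∉ cs (i∉ ∘ there)

    sumBy-findCrit : ∀ (F : Fin D → Maybe (Fin n) → ℚ) cs → Unique (map proj₁ cs) →
      sumBy (λ i → F i (findCrit i cs)) (allFin D) ≡
      sumBy (λ i → F i nothing) (allFin D) + sumBy (λ (i , L) → F i (just L) - F i nothing) cs
    sumBy-findCrit F []             _            = sym (+-identityʳ _)
    sumBy-findCrit F ((i , L) ∷ cs) (i∉cs ∷ u) = begin
      sumBy (λ k → F k (findCrit k ((i , L) ∷ cs))) (allFin D)
        ≡⟨ sumBy-update (Uniqueₚ.allFin⁺ D) (∈-allFin i) (cong (F _) ∘ miss) ⟩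
      sumBy (λ k → F k (findCrit k cs)) (allFin D) + (F i (findCrit i ((i , L) ∷ cs)) - F i (findCrit i cs))
        ≡⟨ cong₂ (λ a b → sumBy (λ k → F k (findCrit k cs)) (allFin D) + (F i a - F i b))
                 hit (findCrit-∉ cs λ i∈cs → All.lookup i∉cs i∈cs refl) ⟩
      sumBy (λ k → F k (findCrit k cs)) (allFin D) + (F i (just L) - F i nothing)
        ≡⟨ cong (_+ _) (sumBy-findCrit F cs u) ⟩
      (N + Δs) + (F i (just L) - F i nothing)
        ≡⟨ solve 3 (λ a b c → (a :+ b) :+ c := a :+ (c :+ b)) refl N Δs _ ⟩
      N + ((F i (just L) - F i nothing) + Δs)  ∎
      where
      open ≡-Reasoning
      open +-*-Solver
      N Δs : ℚ
      N  = sumBy (λ i → F i nothing) (allFin D)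
      Δs = sumBy (λ (i , L) → F i (just L) - F i nothing) cs
      hit : findCrit i ((i , L) ∷ cs) ≡ just L
      hit with i Fin.≟ i
      ... | yes _   = refl
      ... | no  i≢i = contradiction refl i≢i
      miss : ∀ {k} → k ≢ i → findCrit k ((i , L) ∷ cs) ≡ findCrit k cs
      miss {k} k≢i with k Fin.≟ i
      ... | yes k≡i = contradiction k≡i k≢i
      ... | no  _   = refl

    sumBy-nth : ∀ {X : Set} (F : Maybe X → ℚ) → F nothing ≡ 0ℚ → ∀ {k} xs → length xs ℕ.≤ k →
                sumBy (λ t → F (nth xs (toℕ t))) (allFin k) ≡ sumBy (F ∘ just) xs
    sumBy-nth F F0 {ℕ.zero}  []       _            = refl
    sumBy-nth F F0 {ℕ.suc k} []       _            = trans (sumBy-allFin-suc {k} (λ _ → F nothing))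
      (trans (cong₂ _+_ F0 (sumBy-nth F F0 {k} [] ℕ.z≤n)) (+-identityˡ 0ℚ))
    sumBy-nth F F0 {ℕ.suc k} (x ∷ xs) (ℕ.s≤s len≤) =
      trans (sumBy-allFin-suc {k} (λ t → F (nth (x ∷ xs) (toℕ t))))
      (cong (F (just x) +_) (sumBy-nth F F0 xs len≤))

    module _ (s : State) where

      mainValue : Fin D → Maybe (Fin n) → ℚ
      mainValue i = P I ∘ maybe (mainPart s i) (S s i)

      extraValue : Maybe (Fin D × Fin n) → ℚ
      extraValue = P I ∘ maybe (extraPart s) []

      Pfam-corrected : Pfam I (corrected s) ≡
        sumBy (λ i → mainValue i (findCrit i (crit s))) (allFin D) +
        sumBy (λ k → extraValue (nth (crit s) (toℕ k))) (allFin m)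
      Pfam-corrected = begin
        Pfam I (corrected s)
          ≡⟨ sumBy-++ (P I) (map (correctedMain s) (allFin D)) _ ⟩
        sumBy (P I) (map (correctedMain s) (allFin D)) + sumBy (P I) (map (correctedExtra s) (allFin m))
          ≡⟨ cong₂ _+_ (sumBy-map (P I) (correctedMain s) (allFin D))
                       (sumBy-map (P I) (correctedExtra s) (allFin m)) ⟩
        sumBy (P I ∘ correctedMain s) (allFin D) + sumBy (P I ∘ correctedExtra s) (allFin m)
          ≡⟨ cong₂ _+_ (sumBy-cong (All.universal (cong (P I) ∘ correctedMain-findCrit s) (allFin D)))
                       (sumBy-cong (All.universal (cong (P I) ∘ correctedExtra-nth s) (allFin m))) ⟩
        sumBy (λ i → mainValue i (findCrit i (crit s))) (allFin D) +
        sumBy (λ k → extraValue (nth (crit s) (toℕ k))) (allFin m)  ∎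
        where open ≡-Reasoning

    P≤Pfam-corrected : ∀ {s A} → Invariant s A → P I A ≤ Pfam I (corrected s)
    P≤Pfam-corrected {s} {A} inv = begin
      P I A                                         ≡⟨ sumBy-assigned inv p ⟨
      ΣS                                            ≡⟨ +-identityʳ ΣS ⟨
      ΣS + 0ℚ                                       ≤⟨ +-monoʳ-≤ ΣS (sumBy-nonNeg (All.tabulate gain)) ⟩
      ΣS + sumBy (λ c → increment c + extra c) cs   ≡⟨ cong (ΣS +_) (sumBy-+ increment extra cs) ⟩
      ΣS + (sumBy increment cs + sumBy extra cs)    ≡⟨ +-assoc ΣS _ _ ⟨
      (ΣS + sumBy increment cs) + sumBy extra cs    ≡⟨ cong₂ _+_ (sumBy-findCrit (mainValue s) cs (critUnique inv))
                                                                   (sumBy-nth (extraValue s) refl cs (critBound inv)) ⟨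
      sumBy (λ i → mainValue s i (findCrit i cs)) (allFin D) +
      sumBy (λ k → extraValue s (nth cs (toℕ k))) (allFin m)  ≡⟨ Pfam-corrected s ⟨
      Pfam I (corrected s)                          ∎
      where
      open ≤-Reasoning
      open +-*-Solver
      cs : List (Fin D × Fin n)
      cs = crit s
      ΣS : ℚ
      ΣS = sumBy (P I ∘ S s) (allFin D)
      increment extra : Fin D × Fin n → ℚ
      increment (i , L) = P I (mainPart s i L) - P I (S s i)
      extra c = P I (extraPart s c)
      gain : ∀ {c} → c ∈ cs → 0ℚ ≤ increment c + extra c
      gain {i , L} _ = ≤-trans (p≤q⇒0≤q-p (P-split s i L (unique inv i)))
        (≤-reflexive (solve 3 (λ a b e → (a :+ e) :- b := (a :- b) :+ e) refl
                              (P I (mainPart s i L)) (P I (S s i)) (extra (i , L))))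

    ValidFamily-unique : ∀ {O} → ValidFamily I m O → Unique (concat (map O (allFin m)))
    ValidFamily-unique {O} (valid , disjoint) = Uniqueₚ.concat⁺
      (Allₚ.map⁺ (All.universal (proj₁ ∘ valid) (allFin m)))
      (AllPairsₚ.map⁺ (AllPairsₚ.tabulate⁺ λ i≢k (x∈Oi , x∈Ok) → disjoint _ _ i≢k x∈Oi x∈Ok))

    ValidFamily-W≤W : ∀ {s A O} → Invariant s A → m ℕ.≤ length (crit s) → ValidFamily I m O →
                     W I (concat (map O (allFin m))) ≤ W I A
    ValidFamily-W≤W {s} {A} {O} inv full (valid , _) = begin
      W I (concat (map O (allFin m)))     ≡⟨ sumBy-concat c (map O (allFin m)) ⟩
      sumBy (W I) (map O (allFin m))      ≡⟨ sumBy-map (W I) O (allFin m) ⟩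
      sumBy (W I ∘ O) (allFin m)          ≤⟨ sumBy-mono (All.universal (λ k → proj₂ (proj₂ (valid k))) (allFin m)) ⟩
      sumBy (λ _ → B) (allFin m)          ≤⟨ sumBy-const-mono B B≥0 (allFin m) (crit s)
                                               (subst (ℕ._≤ length (crit s)) (sym (length-tabulate id)) full) ⟩
      sumBy (λ _ → B) (crit s)            ≤⟨ sumBy-mono (All.map <⇒≤ (overloaded inv)) ⟩
      sumBy (W I ∘ S s ∘ proj₁) (crit s)  ≡⟨ sumBy-map (W I ∘ S s) proj₁ (crit s) ⟨
      sumBy (W I ∘ S s) (critDrones s)    ≤⟨ sumBy-mono-⊆ (critUnique inv) (λ {i} _ → ∈-allFin i)
                                               (All.universal (λ i → sumBy-nonNeg (All.universal c≥0 (S s i))) (allFin D)) ⟩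
      sumBy (W I ∘ S s) (allFin D)        ≡⟨ sumBy-assigned inv c ⟩
      W I A                               ∎
      where open ≤-Reasoning

    overloaded-drone : ∀ {s A} → Invariant s A → 1 ℕ.≤ length (crit s) → ∃ (Overloaded s)
    overloaded-drone {s} inv nonEmpty with crit s | overloaded inv
    ... | (i , _) ∷ _ | B<W ∷ _ = i , B<W

    OPT≤P-processed : ∀ {s A R} → 1 ℕ.≤ m → Invariant s A → (∀ j → j ∈ A ++ R) →
                      DensitySorted I (A ++ R) → Halted s R → OPT≤ I m (P I A)
    OPT≤P-processed {A = A} _ _ complete _ exhausted O valid = begin
      Pfam I (map O (allFin m))         ≡⟨ sumBy-concat p (map O (allFin m)) ⟨
      P I (concat (map O (allFin m)))   ≤⟨ sumBy-mono-⊆ (ValidFamily-unique valid) (λ {j} _ → processed j)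
                                                          (All.universal p≥0 A) ⟩
      P I A                             ∎
      where
      open ≤-Reasoning
      processed : ∀ j → j ∈ A
      processed j = subst (j ∈_) (++-identityʳ A) (complete j)
    OPT≤P-processed {s} {A} {r ∷ rs} m≥1 inv complete sorted (saturated full) O valid
      with density I r | densityView r | DensitySorted-split A sorted
    ... | ∞ | free _ | above , _ =
      let i , B<W = overloaded-drone inv (ℕ.≤-trans m≥1 full)
      in contradiction (<-≤-trans B<W (≤-trans (weightless i) B≥0)) (<-irrefl refl)
      where
      weightless : ∀ i → W I (S s i) ≤ 0ℚ
      weightless i = sumBy-nonPos (All.tabulate λ x∈S →
        ≤-reflexive (∞≤density⇒c≡0 (All.lookup above (assigned⊆ inv i x∈S))))
    ... | fin d | priced _ 0≤d d*c≡p | above , below = begin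
      Pfam I (map O (allFin m))         ≡⟨ sumBy-concat p (map O (allFin m)) ⟨
      P I (concat (map O (allFin m)))   ≤⟨ sumBy-≤-threshold p c d (ValidFamily-unique valid)
                                             (All.tabulate (λ {j} _ → classify j))
                                             (All.tabulate (fin≤density⇒*c≤p ∘ All.lookup above)) budget ⟩
      P I A                             ∎
      where
      open ≤-Reasoning
      classify : ∀ j → j ∈ A ⊎ p j ≤ d * c j
      classify j with ∈-++⁻ A (complete j)
      ... | inj₁ j∈A          = inj₁ j∈A
      ... | inj₂ (here refl)  = inj₂ (≤-reflexive (sym d*c≡p))
      ... | inj₂ (there j∈rs) = inj₂ (density≤fin⇒p≤*c (All.lookup below j∈rs))
      budget : d * W I (concat (map O (allFin m))) ≤ d * W I A
      budget = *-monoˡ-≤-nonNeg d {{nonNegative 0≤d}} (ValidFamily-W≤W inv full valid)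

    greedyRun-from-initial : ∀ {order s′} → order ↭ allFin n → GreedyRun initial order s′ →
      ∃₂ λ A R → order ≡ A ++ R × Invariant s′ A × Halted s′ R
    greedyRun-from-initial order↭allFin =
      greedyRun-invariant [] initial-invariant
        (Setoid↭.Unique-resp-↭ (setoid (Fin n)) (↭⇒↭ₛ (↭-sym order↭allFin)) (Uniqueₚ.allFin⁺ n))

-- The degree bound Δ only guarantees that Step 2 always finds a drone with no conflicting job;
-- the reward bound holds for every run of the greedy phase.
theorem4 : (m n Δ : ℕ) (I : Instance n) → IsMaxDegree I Δ →
    (order : List (Fin n)) → order ↭ allFin n → DensitySorted I order →
    (s' : Greedy.State I m Δ) → Greedy.GreedyRun I m Δ (Greedy.initial I m Δ) order s' →
    OPT≤ I m (Pfam I (Greedy.corrected I m Δ s'))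
theorem4 ℕ.zero n Δ I _ _ _ _ s' _ _ _ =
  sumBy-nonNeg (All.universal (λ S → sumBy-nonNeg (All.universal (Instance.p≥0 I) S)) (Greedy.corrected I 0 Δ s'))
theorem4 m@(ℕ.suc _) n Δ I _ order order↭allFin sorted s' run
  with A , R , refl , inv , halted ← greedyRun-from-initial I m Δ order↭allFin run
  = λ O valid → ≤-trans (OPT≤P-processed I m Δ (ℕ.s≤s ℕ.z≤n) inv complete sorted halted O valid)
                        (P≤Pfam-corrected I m Δ inv)
  where
  complete : ∀ j → j ∈ A ++ R
  complete j = ∈-resp-↭ (↭-sym order↭allFin) (∈-allFin j)
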